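{- Let $d\ge 2$, let $[n]=\{1,\dots,n\}$ and let $H$ be a set with $|H|=d-2$ and $[n]\cap H=\emptyset$. Let $\mathcal{C}$ be a pure $d$-dimensional $1$-decomposable simplicial complex on vertex set $[n]\cup H$ that is fully coned with respect to $H$, and assume that the induced subgraph of $\mathrm{skel}(\mathcal{C})$ on $[n]$ is connected. Let $\Delta_{n+d-3}^{(d)}$ be the complex on $[n]\cup H$ whose facets are all $(d+1)$-element subsets of $[n]\cup H$. Then the facets of $\Delta_{n+d-3}^{(d)}$ not in $\mathcal{C}$ can be ordered $F_1,\dots,F_t$ so that $\mathcal{C}+\langle F_1,\dots,F_i\rangle$ is $1$-decomposable for all $1\le i\le t$.
   Context: Simplicial complexes, faces, vertices, facets, dimension and purity are as usual. $\langle F_1,\dots,F_k\rangle$ is the complex with facets $F_1,\dots,F_k$, and $\mathcal{C}+\langle G_1,\dots,G_k\rangle$ is the complex generated by the facets of $\mathcal{C}$ and $G_1,\dots,G_k$. For a nonempty face $F$: $\mathrm{lk}_F\mathcal{C}=\{G\in\mathcal{C}: G\cap F=\emptyset, G\cup F\in\mathcal{C}\}$, $\mathrm{del}_F\mathcal{C}=\{G\in\mathcal{C}: F\not\subseteq G\}$. A pure $d$-dimensional complex is $k$-decomposable if it is a simplex (one facet), or it has a face $F$ with $\dim F\le k$ such that $\mathrm{del}_F\mathcal{C}$ and $\mathrm{lk}_F\mathcal{C}$ are $k$-decomposable and $\mathrm{del}_F\mathcal{C}$ is pure of dimension $d$. $\mathrm{skel}(\mathcal{C})$ is the graph on the vertices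 of $\mathcal{C}$ whose edges are the $2$-element faces of $\mathcal{C}$. For $d\ge2$, a pure $d$-dimensional complex $\mathcal{C}$ is fully coned with respect to a subset $H$ of its vertex set if (i) every $h\in H$ is adjacent in $\mathrm{skel}(\mathcal{C})$ to every other vertex, and (ii) every $(d+1)$-clique of $\mathrm{skel}(\mathcal{C})$ is a facet of $\mathcal{C}$. -}

module Defs where

open import Data.Nat using (ℕ; zero; suc; _≤_; _+_; _∸_)
open import Data.Fin using (Fin; _↑ˡ_; _↑ʳ_)
open import Data.Fin.Subset using (Subset; _⊆_; _∪_; _∩_; ∣_∣; ⁅_⁆; Nonempty; Empty; _∈_; ⊥)
open import Data.List using (List; take; length)
open import Data.List.Relation.Unary.Any using (Any)
open import Data.Product using (Σ; _×_; ∃)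
open import Data.Sum using (_⊎_)
open import Relation.Nullary using (¬_)
open import Relation.Binary.PropositionalEquality using (_≡_; _≢_)
open import Relation.Binary.Construct.Closure.ReflexiveTransitive using (Star)
open import Function.Bundles using (_⇔_)

Cx : ℕ → Set₁
Cx m = Subset m → Set

module _ {m : ℕ} where

  IsComplex : Cx m → Set
  IsComplex C = ∀ F G → G ⊆ F → C F → C G

  Facet : Cx m → Subset m → Set
  Facet C F = C F × (∀ G → C G → F ⊆ G → F ≡ G)

  -- pure with all facets of cardinality s (i.e. of dimension s - 1), nonempty
  PureCard : Cx m → ℕ → Set
  PureCard C s = (Σ (Subset m) C)
               × (∀ G → C G → Σ (Subset m) λ F → Facet C F × G ⊆ F)
               × (∀ F → Facet C F → ∣ F ∣ ≡ s)

  PureDim : Cx m → ℕ → Set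
  PureDim C d = PureCard C (suc d)

  del : Subset m → Cx m → Cx m
  del F C G = C G × ¬ (F ⊆ G)

  lk : Subset m → Cx m → Cx m
  lk F C G = Empty (G ∩ F) × C (G ∪ F)

  IsSimplex : Cx m → Set
  IsSimplex C = Σ (Subset m) λ σ → ∀ G → C G ⇔ (G ⊆ σ)

  -- k-decomposability (for pure complexes, of whatever dimension, including
  -- the dimension -1 complex {∅} arising as links of facets).
  -- The shedding face F is nonempty with dim F ≤ k, i.e. |F| ≤ k + 1.
  data Decomposable (k : ℕ) : Cx m → Set₁ where
    simplex : ∀ {C} → IsSimplex C → Decomposable k C
    shed    : ∀ {C} (s : ℕ) → PureCard C s →
              (F : Subset m) → C F → Nonempty F → ∣ F ∣ ≤ suc k →
              PureCard (del F C) s →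
              Decomposable k (del F C) → Decomposable k (lk F C) →
              Decomposable k C

  Adj : Cx m → Fin m → Fin m → Set
  Adj C u v = u ≢ v × C (⁅ u ⁆ ∪ ⁅ v ⁆)

  _⊕_ : Cx m → List (Subset m) → Cx m
  (C ⊕ Gs) F = C F ⊎ Any (F ⊆_) Gs

  Clique : Cx m → Subset m → Set
  Clique C K = ∀ u v → u ∈ K → v ∈ K → u ≢ v → Adj C u v

  FullyConed : ℕ → Cx m → (Fin m → Set) → Set
  FullyConed d C H =
    (∀ h v → H h → h ≢ v → Adj C h v) ×
    (∀ K → ∣ K ∣ ≡ suc d → Clique C K → Facet C K)

-- Vertex set [n] ∪ H is modelled as Fin (n + (d ∸ 2)):
-- [n] = i ↑ˡ (d ∸ 2), H = n ↑ʳ j (so |H| = d - 2, [n] ∩ H = ∅).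
V : ℕ → ℕ → Set
V n d = Fin (n + (d ∸ 2))

vtx : ∀ {n} d → Fin n → V n d
vtx d i = i ↑ˡ (d ∸ 2)

InH : ∀ n d → V n d → Set
InH n d v = ∃ λ (j : Fin (d ∸ 2)) → n ↑ʳ j ≡ v

InducedConnected : ∀ n d → Cx (n + (d ∸ 2)) → Set
InducedConnected n d C =
  ∀ (i j : Fin n) → Star (λ a b → Adj C (vtx d a) (vtx d b)) i j

AllVertices : ∀ {m} → Cx m → Set
AllVertices {m} C = ∀ (v : Fin m) → C ⁅ v ⁆

{-# OPTIONS --safe #-}
-- The complex is grown until its skeleton is complete, keeping it equal to the complex generated by the
-- (d+1)-cliques of a graph G ⊇ skel(C) in which every d-clique lies in a (d+1)-clique.  As H is joined to
-- every vertex and skel(C) is connected on [n], a missing edge uv has a common neighbour w ∉ H.  Adding uv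
-- adds the facets W ∪ {u, v}, W a (d-1)-clique of U = nbr u ∩ nbr v, one at a time, and each time uv is a
-- shedding face: its deletion is the previous complex, because a face of W ∪ {u, v} missing u (say) lies in
-- the d-clique W ∪ {v} and hence in a (d+1)-clique of G, and its link is generated by the W's added so far.
-- These links are 1-decomposable for a suitable order of the W's because U contains H ∪ {w} with H joined
-- to all of U: the (d-1)-cliques of U are enumerated by inserting the vertices of U one at a time, each new
-- vertex being a shedding vertex whose link is the same kind of clique complex one dimension lower.
module Submission where

open import Defs
open import Data.Nat using (ℕ; zero; suc; _≤_; _<_; _+_; _∸_; s≤s; z≤n)
open import Data.Nat.ListAction using (sum)
open import Data.Nat.Properties
  using (<⇒≱; n≮0; ≤-reflexive; ≤-trans; ≤-refl; ≤-total; suc-injective;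
         +-mono-≤; +-mono-<-≤; +-mono-≤-<; n<1+n; m<n⇒m<1+n)
open import Data.Nat.Induction using (<-wellFounded)
open import Induction.WellFounded using (Acc; acc)
open import Data.Fin using (Fin; zero; suc; _≟_; _↑ˡ_; _↑ʳ_; splitAt)
open import Data.Fin.Properties using (¬∀⟶∃¬; all?; join-splitAt)
open import Data.Fin.Subset
  using (Subset; _⊆_; _⊈_; _∪_; _∩_; _─_; _-_; ∣_∣; ⁅_⁆; _∈_; _∉_; ⊥; ⊤; ∁;
         Nonempty; Empty; inside; outside)
open import Data.Fin.Subset.Properties
  using (_∈?_; _⊆?_; ⊆-refl; ⊆-reflexive; ⊆-antisym; p⊆q⇒∣p∣≤∣q∣; p⊂q⇒∣p∣<∣q∣;
         p⊆q⇒∁p⊇∁q; p⊂q⇒∁p⊃∁q; p⊆p∪q; q⊆p∪q; x∈p∪q⁻; x∈p∪q⁺; ∪-assoc; ∪-comm; ∪-identityʳ;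
         p∩q⊆p; p∩q⊆q; x∈p∩q⁺; x∈p∩q⁻; p─q⊆p; x∈p∧x∉q⇒x∈p─q; x∈p⇒∣p-x∣<∣p∣;
         x∈⁅x⁆; x∈⁅y⁆⇒x≡y; ∣⁅x⁆∣≡1; ∣⊥∣≡0; ∈⊤; ∣⊤∣≡n)
open import Data.Vec.Base using (_∷_; here; there; tabulate)
open import Data.List using (List; []; _∷_; _++_; map; take; length; allFin)
open import Data.List.Properties using (take-all; take-map; take-[])
open import Data.List.Membership.Propositional using (find; lose) renaming (_∈_ to _∈ₗ_)
open import Data.List.Membership.Propositional.Properties
  using (∈-map⁺; ∈-map⁻; ∈-++⁺ˡ; ∈-++⁺ʳ; ∈-allFin)
open import Data.List.Relation.Unary.Any using (Any; here; there)
import Data.List.Relation.Unary.Any.Properties as Any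
open import Data.List.Relation.Unary.All using (All; []; _∷_)
import Data.List.Relation.Unary.All as All
import Data.List.Relation.Unary.All.Properties as All
open import Data.List.Relation.Unary.AllPairs using ([]; _∷_)
open import Data.List.Relation.Unary.Unique.Propositional using (Unique)
import Data.List.Relation.Unary.Unique.Propositional.Properties as Unique
open import Data.List.Relation.Binary.Disjoint.Propositional using (Disjoint)
open import Data.Product using (Σ; ∃; ∃₂; _×_; _,_; proj₁; proj₂; swap)
import Data.Product as Product
open import Data.Sum using (_⊎_; inj₁; inj₂; [_,_])
import Data.Sum as Sum
open import Function using (id; _∘_)
open import Function.Bundles using (_⇔_; mk⇔; Equivalence)
import Function.Properties.Equivalence as ⇔
open import Relation.Nullary using (¬_; Dec; yes; no; does; contradiction)
open import Relation.Nullary.Decidable using (map′; _→-dec_; _⊎-dec_)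
open import Relation.Unary using (Decidable)
open import Relation.Binary.PropositionalEquality
  using (_≡_; _≢_; refl; sym; trans; cong; subst; subst₂; module ≡-Reasoning)
open import Relation.Binary.Construct.Closure.ReflexiveTransitive using (Star; ε; _◅_; gmap)

open Equivalence using (to; from)

take-++ˡ : ∀ {A : Set} i (L N : List A) → i ≤ length L → take i (L ++ N) ≡ take i L
take-++ˡ zero    L       N _         = refl
take-++ˡ (suc i) (x ∷ L) N (s≤s i≤∣L∣) = cong (x ∷_) (take-++ˡ i L N i≤∣L∣)

take-++ʳ : ∀ {A : Set} i (L N : List A) → length L ≤ i → take i (L ++ N) ≡ L ++ take (i ∸ length L) N
take-++ʳ i       []      N _           = refl
take-++ʳ (suc i) (x ∷ L) N (s≤s ∣L∣≤i) = cong (x ∷_) (take-++ʳ i L N ∣L∣≤i)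

sum-map-≤ : ∀ {A : Set} {f g : A → ℕ} → (∀ x → f x ≤ g x) → ∀ xs → sum (map f xs) ≤ sum (map g xs)
sum-map-≤ f≤g []       = z≤n
sum-map-≤ f≤g (x ∷ xs) = +-mono-≤ (f≤g x) (sum-map-≤ f≤g xs)

sum-map-< : ∀ {A : Set} {f g : A → ℕ} → (∀ x → f x ≤ g x) →
  ∀ {z xs} → z ∈ₗ xs → f z < g z → sum (map f xs) < sum (map g xs)
sum-map-< f≤g {xs = x ∷ xs} (here refl) fz<gz = +-mono-<-≤ fz<gz (sum-map-≤ f≤g xs)
sum-map-< f≤g {xs = x ∷ xs} (there z∈xs) fz<gz = +-mono-≤-< (f≤g x) (sum-map-< f≤g z∈xs fz<gz)

Star-exit : ∀ {A : Set} {R : A → A → Set} {P : A → Set} → Decidable P →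
  ∀ {x y} → Star R x y → P x → ¬ P y → ∃₂ λ a b → R a b × P a × ¬ P b
Star-exit P? ε px ¬py = contradiction px ¬py
Star-exit P? (_◅_ {j = z} r path) px ¬py with P? z
... | yes pz  = Star-exit P? path pz ¬py
... | no ¬pz = _ , z , r , px , ¬pz

⊈-witness : ∀ {m} {p q : Subset m} → p ⊈ q → ∃ λ x → x ∈ p × x ∉ q
⊈-witness {p = p} {q} p⊈q
  with ¬∀⟶∃¬ _ (λ x → x ∈ p → x ∈ q) (λ x → x ∈? p →-dec x ∈? q) (λ p⊆q → p⊈q (p⊆q _))
... | x , x∈p⇏x∈q with x ∈? p | x ∈? q
...   | yes x∈p | yes x∈q = contradiction (λ _ → x∈q) x∈p⇏x∈q
...   | yes x∈p | no x∉q  = x , x∈p , x∉q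
...   | no x∉p  | _       = contradiction (λ x∈p → contradiction x∈p x∉p) x∈p⇏x∈q

∣p∣<∣q∣⇒q⊈p : ∀ {m} {p q : Subset m} → ∣ p ∣ < ∣ q ∣ → q ⊈ p
∣p∣<∣q∣⇒q⊈p ∣p∣<∣q∣ q⊆p = <⇒≱ ∣p∣<∣q∣ (p⊆q⇒∣p∣≤∣q∣ q⊆p)

p⊆q∧∣q∣≤∣p∣⇒p≡q : ∀ {m} {p q : Subset m} → p ⊆ q → ∣ q ∣ ≤ ∣ p ∣ → p ≡ q
p⊆q∧∣q∣≤∣p∣⇒p≡q {p = p} {q} p⊆q ∣q∣≤∣p∣ with q ⊆? p
... | yes q⊆p = ⊆-antisym p⊆q q⊆p
... | no q⊈p  = let x , x∈q , x∉p = ⊈-witness q⊈p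
                in contradiction ∣q∣≤∣p∣ (<⇒≱ (p⊂q⇒∣p∣<∣q∣ (p⊆q , x , x∈q , x∉p)))

∣p∣≡0⇒x∉p : ∀ {m} {p : Subset m} {x : Fin m} → ∣ p ∣ ≡ 0 → x ∉ p
∣p∣≡0⇒x∉p {p = p} {x} ∣p∣≡0 x∈p = n≮0 (subst (∣ p - x ∣ <_) ∣p∣≡0 (x∈p⇒∣p-x∣<∣p∣ x∈p))

x∈p─q⇒x∉q : ∀ {m} {p q : Subset m} {x : Fin m} → x ∈ p ─ q → x ∉ q
x∈p─q⇒x∉q {p = inside ∷ p} {q = outside ∷ q} here ()
x∈p─q⇒x∉q {p = _ ∷ p} {q = _ ∷ q} (there x∈p─q) (there x∈q) = x∈p─q⇒x∉q x∈p─q x∈q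

q⊆p⇒p─q∪q≡p : ∀ {m} {p q : Subset m} → q ⊆ p → (p ─ q) ∪ q ≡ p
q⊆p⇒p─q∪q≡p {p = p} {q} q⊆p = ⊆-antisym (λ x∈ → [ p─q⊆p p q , q⊆p ] (x∈p∪q⁻ (p ─ q) q x∈)) p⊆p─q∪q
  where
  p⊆p─q∪q : p ⊆ (p ─ q) ∪ q
  p⊆p─q∪q {x} x∈p with x ∈? q
  ... | yes x∈q = x∈p∪q⁺ (inj₂ x∈q)
  ... | no x∉q  = x∈p∪q⁺ (inj₁ (x∈p∧x∉q⇒x∈p─q x∈p x∉q))

x∈p∪⁅y⁆⁻ : ∀ {m} (p : Subset m) {x y : Fin m} → x ∈ p ∪ ⁅ y ⁆ → x ∈ p ⊎ x ≡ y
x∈p∪⁅y⁆⁻ p {y = y} x∈ = Sum.map₂ (x∈⁅y⁆⇒x≡y y) (x∈p∪q⁻ p ⁅ y ⁆ x∈)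

x∈⁅y⁆∪⁅z⁆⁻ : ∀ {m} {x y z : Fin m} → x ∈ ⁅ y ⁆ ∪ ⁅ z ⁆ → x ≡ y ⊎ x ≡ z
x∈⁅y⁆∪⁅z⁆⁻ {y = y} {z} x∈ = Sum.map (x∈⁅y⁆⇒x≡y y) (x∈⁅y⁆⇒x≡y z) (x∈p∪q⁻ ⁅ y ⁆ ⁅ z ⁆ x∈)

x∈p∪⁅y⁆∪⁅z⁆⁻ : ∀ {m} (p : Subset m) {x y z : Fin m} →
  x ∈ p ∪ ⁅ y ⁆ ∪ ⁅ z ⁆ → x ∈ p ⊎ x ≡ y ⊎ x ≡ z
x∈p∪⁅y⁆∪⁅z⁆⁻ p {y = y} {z} x∈ = Sum.map₂ x∈⁅y⁆∪⁅z⁆⁻ (x∈p∪q⁻ p (⁅ y ⁆ ∪ ⁅ z ⁆) x∈)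

x∈p⇒⁅x⁆⊆p : ∀ {m} {p : Subset m} {x : Fin m} → x ∈ p → ⁅ x ⁆ ⊆ p
x∈p⇒⁅x⁆⊆p {x = x} x∈p y∈⁅x⁆ with x∈⁅y⁆⇒x≡y x y∈⁅x⁆
... | refl = x∈p

x,y∈p⇒⁅x⁆∪⁅y⁆⊆p : ∀ {m} {p : Subset m} {x y : Fin m} → x ∈ p → y ∈ p → ⁅ x ⁆ ∪ ⁅ y ⁆ ⊆ p
x,y∈p⇒⁅x⁆∪⁅y⁆⊆p x∈p y∈p z∈ = [ (λ { refl → x∈p }) , (λ { refl → y∈p }) ] (x∈⁅y⁆∪⁅z⁆⁻ z∈)

x∉p⇒∣p∪⁅x⁆∣≡1+∣p∣ : ∀ {m} {p : Subset m} {x : Fin m} → x ∉ p → ∣ p ∪ ⁅ x ⁆ ∣ ≡ suc ∣ p ∣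
x∉p⇒∣p∪⁅x⁆∣≡1+∣p∣ {p = outside ∷ p} {zero}  x∉p = cong suc (cong ∣_∣ (∪-identityʳ p))
x∉p⇒∣p∪⁅x⁆∣≡1+∣p∣ {p = inside ∷ p}  {zero}  x∉p = contradiction here x∉p
x∉p⇒∣p∪⁅x⁆∣≡1+∣p∣ {p = outside ∷ p} {suc x} x∉p = x∉p⇒∣p∪⁅x⁆∣≡1+∣p∣ (x∉p ∘ there)
x∉p⇒∣p∪⁅x⁆∣≡1+∣p∣ {p = inside ∷ p}  {suc x} x∉p = cong suc (x∉p⇒∣p∪⁅x⁆∣≡1+∣p∣ (x∉p ∘ there))

x∈p⇒1+∣p-x∣≡∣p∣ : ∀ {m} {p : Subset m} {x : Fin m} → x ∈ p → suc ∣ p - x ∣ ≡ ∣ p ∣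
x∈p⇒1+∣p-x∣≡∣p∣ {p = p} {x} x∈p = begin
  suc ∣ p - x ∣       ≡⟨ x∉p⇒∣p∪⁅x⁆∣≡1+∣p∣ (λ x∈p-x → x∈p─q⇒x∉q {p = p} x∈p-x (x∈⁅x⁆ x)) ⟨
  ∣ (p - x) ∪ ⁅ x ⁆ ∣ ≡⟨ cong ∣_∣ (q⊆p⇒p─q∪q≡p (x∈p⇒⁅x⁆⊆p x∈p)) ⟩
  ∣ p ∣               ∎
  where open ≡-Reasoning

∣p∪⁅x⁆∪⁅y⁆∣≡2+∣p∣ : ∀ {m} {p : Subset m} {x y : Fin m} → x ∉ p → y ∉ p → x ≢ y →
  ∣ p ∪ ⁅ x ⁆ ∪ ⁅ y ⁆ ∣ ≡ 2 + ∣ p ∣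
∣p∪⁅x⁆∪⁅y⁆∣≡2+∣p∣ {p = p} {x} {y} x∉p y∉p x≢y = begin
  ∣ p ∪ ⁅ x ⁆ ∪ ⁅ y ⁆ ∣   ≡⟨ cong ∣_∣ (∪-assoc p ⁅ x ⁆ ⁅ y ⁆) ⟨
  ∣ (p ∪ ⁅ x ⁆) ∪ ⁅ y ⁆ ∣ ≡⟨ x∉p⇒∣p∪⁅x⁆∣≡1+∣p∣ y∉p∪⁅x⁆ ⟩
  suc ∣ p ∪ ⁅ x ⁆ ∣       ≡⟨ cong suc (x∉p⇒∣p∪⁅x⁆∣≡1+∣p∣ x∉p) ⟩
  2 + ∣ p ∣               ∎
  where
  open ≡-Reasoning
  y∉p∪⁅x⁆ : y ∉ p ∪ ⁅ x ⁆
  y∉p∪⁅x⁆ y∈ = [ y∉p , x≢y ∘ sym ] (x∈p∪⁅y⁆⁻ p y∈)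

x∈p∪⁅x⁆∪⁅y⁆ : ∀ {m} (p : Subset m) {x y : Fin m} → x ∈ p ∪ ⁅ x ⁆ ∪ ⁅ y ⁆
x∈p∪⁅x⁆∪⁅y⁆ p {x} {y} = q⊆p∪q p (⁅ x ⁆ ∪ ⁅ y ⁆) (p⊆p∪q ⁅ y ⁆ (x∈⁅x⁆ x))

y∈p∪⁅x⁆∪⁅y⁆ : ∀ {m} (p : Subset m) {x y : Fin m} → y ∈ p ∪ ⁅ x ⁆ ∪ ⁅ y ⁆
y∈p∪⁅x⁆∪⁅y⁆ p {x} {y} = q⊆p∪q p (⁅ x ⁆ ∪ ⁅ y ⁆) (q⊆p∪q ⁅ x ⁆ ⁅ y ⁆ (x∈⁅x⁆ y))

p⊆q∧∣q∣≡2+∣p∣⇒q≡p∪⁅x⁆∪⁅y⁆ : ∀ {m} {p q : Subset m} → p ⊆ q → ∣ q ∣ ≡ 2 + ∣ p ∣ →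
  ∃₂ λ x y → x ∉ p × y ∉ p × x ≢ y × q ≡ p ∪ ⁅ x ⁆ ∪ ⁅ y ⁆
p⊆q∧∣q∣≡2+∣p∣⇒q≡p∪⁅x⁆∪⁅y⁆ {p = p} {q} p⊆q ∣q∣≡2+∣p∣
  with ⊈-witness (∣p∣<∣q∣⇒q⊈p {p = p} {q} (subst (∣ p ∣ <_) (sym ∣q∣≡2+∣p∣) (m<n⇒m<1+n (n<1+n _))))
... | x , x∈q , x∉p
  with ⊈-witness (∣p∣<∣q∣⇒q⊈p {p = p ∪ ⁅ x ⁆} {q}
                    (subst₂ _<_ (sym (x∉p⇒∣p∪⁅x⁆∣≡1+∣p∣ x∉p)) (sym ∣q∣≡2+∣p∣) (n<1+n _)))
...   | y , y∈q , y∉p∪⁅x⁆ =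
  x , y , x∉p , y∉p , x≢y ,
  sym (p⊆q∧∣q∣≤∣p∣⇒p≡q p∪⁅x⁆∪⁅y⁆⊆q
         (≤-reflexive (trans ∣q∣≡2+∣p∣ (sym (∣p∪⁅x⁆∪⁅y⁆∣≡2+∣p∣ x∉p y∉p x≢y)))))
  where
  y∉p : y ∉ p
  y∉p = y∉p∪⁅x⁆ ∘ p⊆p∪q ⁅ x ⁆
  x≢y : x ≢ y
  x≢y x≡y = y∉p∪⁅x⁆ (q⊆p∪q p ⁅ x ⁆ (subst (_∈ ⁅ x ⁆) x≡y (x∈⁅x⁆ x)))
  p∪⁅x⁆∪⁅y⁆⊆q : p ∪ ⁅ x ⁆ ∪ ⁅ y ⁆ ⊆ q
  p∪⁅x⁆∪⁅y⁆⊆q z∈ = [ p⊆q , [ (λ { refl → x∈q }) , (λ { refl → y∈q }) ] ] (x∈p∪⁅y⁆∪⁅z⁆⁻ p z∈)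

Empty-∩⁻ : ∀ {m} {p q : Subset m} {x : Fin m} → Empty (p ∩ q) → x ∈ p → x ∉ q
Empty-∩⁻ empty x∈p x∈q = empty (_ , x∈p∩q⁺ (x∈p , x∈q))

Empty-∩⁺ : ∀ {m} {p q : Subset m} → (∀ {x} → x ∈ p → x ∉ q) → Empty (p ∩ q)
Empty-∩⁺ {p = p} {q} disjoint (_ , x∈p∩q) = let x∈p , x∈q = x∈p∩q⁻ p q x∈p∩q in disjoint x∈p x∈q

∪-monoˡ-⊆ : ∀ {m} {p q : Subset m} (r : Subset m) → p ⊆ q → p ∪ r ⊆ q ∪ r
∪-monoˡ-⊆ {p = p} r p⊆q x∈ = x∈p∪q⁺ (Sum.map₁ p⊆q (x∈p∪q⁻ p r x∈))

∪-cancelʳ-⊆ : ∀ {m} {p q r : Subset m} → Empty (p ∩ r) → p ∪ r ⊆ q ∪ r → p ⊆ q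
∪-cancelʳ-⊆ {q = q} {r} p∩r≡∅ p∪r⊆q∪r x∈p =
  [ id , (λ x∈r → contradiction x∈r (Empty-∩⁻ p∩r≡∅ x∈p)) ] (x∈p∪q⁻ q r (p∪r⊆q∪r (p⊆p∪q r x∈p)))

∪-cancelʳ : ∀ {m} {p q r : Subset m} → Empty (p ∩ r) → Empty (q ∩ r) → p ∪ r ≡ q ∪ r → p ≡ q
∪-cancelʳ p∩r≡∅ q∩r≡∅ eq =
  ⊆-antisym (∪-cancelʳ-⊆ p∩r≡∅ (⊆-reflexive eq)) (∪-cancelʳ-⊆ q∩r≡∅ (⊆-reflexive (sym eq)))

⊆∪⁅x⁆∪⁅y⁆-miss : ∀ {m} {p q : Subset m} {x y : Fin m} →
  p ⊆ q ∪ ⁅ x ⁆ ∪ ⁅ y ⁆ → x ∉ p → p ⊆ q ∪ ⁅ y ⁆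
⊆∪⁅x⁆∪⁅y⁆-miss {q = q} {y = y} p⊆ x∉p z∈p with x∈p∪⁅y⁆∪⁅z⁆⁻ q (p⊆ z∈p)
... | inj₁ z∈q         = p⊆p∪q ⁅ y ⁆ z∈q
... | inj₂ (inj₁ refl) = contradiction z∈p x∉p
... | inj₂ (inj₂ refl) = q⊆p∪q q ⁅ y ⁆ (x∈⁅x⁆ y)

⊆∪pair⇒⊆∪one : ∀ {m} {p q : Subset m} {x y : Fin m} →
  p ⊆ q ∪ ⁅ x ⁆ ∪ ⁅ y ⁆ → ⁅ x ⁆ ∪ ⁅ y ⁆ ⊈ p → ∃ λ b → b ∈ ⁅ x ⁆ ∪ ⁅ y ⁆ × p ⊆ q ∪ ⁅ b ⁆
⊆∪pair⇒⊆∪one {p = p} {q} {x} {y} p⊆ pair⊈p with x ∈? p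
... | no x∉p  = y , q⊆p∪q ⁅ x ⁆ ⁅ y ⁆ (x∈⁅x⁆ y) , ⊆∪⁅x⁆∪⁅y⁆-miss p⊆ x∉p
... | yes x∈p = x , p⊆p∪q ⁅ y ⁆ (x∈⁅x⁆ x) ,
  ⊆∪⁅x⁆∪⁅y⁆-miss (subst (λ σ → p ⊆ q ∪ σ) (∪-comm ⁅ x ⁆ ⁅ y ⁆) p⊆) (pair⊈p ∘ x,y∈p⇒⁅x⁆∪⁅y⁆⊆p x∈p)

select : ∀ {m} {P : Fin m → Set} → Decidable P → Subset m
select P? = tabulate (does ∘ P?)

∈-select⁺ : ∀ {m} {P : Fin m → Set} (P? : Decidable P) {x} → P x → x ∈ select P?
∈-select⁺ P? {zero} px with P? zero
... | yes _  = here
... | no ¬px = contradiction px ¬px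
∈-select⁺ P? {suc x} px = there (∈-select⁺ (P? ∘ suc) px)

∈-select⁻ : ∀ {m} {P : Fin m → Set} (P? : Decidable P) {x} → x ∈ select P? → P x
∈-select⁻ P? {zero} x∈ with P? zero | x∈
... | yes px | _ = px
... | no _   | ()
∈-select⁻ P? {suc x} (there x∈) = ∈-select⁻ (P? ∘ suc) x∈

module _ {m : ℕ} where

  infix 4 _≐_

  _≐_ : Cx m → Cx m → Set
  C ≐ D = ∀ G → C G ⇔ D G

  ≐-sym : {C D : Cx m} → C ≐ D → D ≐ C
  ≐-sym C≐D G = ⇔.sym (C≐D G)

  ≐-trans : {C D E : Cx m} → C ≐ D → D ≐ E → C ≐ E
  ≐-trans C≐D D≐E G = ⇔.trans (C≐D G) (D≐E G)

  Facet-resp : ∀ {C D : Cx m} {F} → C ≐ D → Facet C F → Facet D F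
  Facet-resp C≐D (cF , maximal) = to (C≐D _) cF , λ G dG F⊆G → maximal G (from (C≐D G) dG) F⊆G

  PureCard-resp : ∀ {C D : Cx m} {s} → C ≐ D → PureCard C s → PureCard D s
  PureCard-resp C≐D ((F , cF) , covered , sized) =
    (F , to (C≐D F) cF) ,
    (λ G dG → Product.map₂ (Product.map₁ (Facet-resp C≐D)) (covered G (from (C≐D G) dG))) ,
    (λ F facet → sized F (Facet-resp (≐-sym C≐D) facet))

  del-resp : ∀ {C D : Cx m} F → C ≐ D → del F C ≐ del F D
  del-resp F C≐D G = mk⇔ (Product.map₁ (to (C≐D G))) (Product.map₁ (from (C≐D G)))

  lk-resp : ∀ {C D : Cx m} F → C ≐ D → lk F C ≐ lk F D
  lk-resp F C≐D G = mk⇔ (Product.map₂ (to (C≐D _))) (Product.map₂ (from (C≐D _)))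

  Decomposable-resp : ∀ {k} {C D : Cx m} → C ≐ D → Decomposable k C → Decomposable k D
  Decomposable-resp C≐D (simplex (σ , C⇔⊆σ)) = simplex (σ , λ G → ⇔.trans (⇔.sym (C≐D G)) (C⇔⊆σ G))
  Decomposable-resp C≐D (shed s pure F cF nonempty small pureDel decDel decLk) =
    shed s (PureCard-resp C≐D pure) F (to (C≐D F) cF) nonempty small
      (PureCard-resp (del-resp F C≐D) pureDel)
      (Decomposable-resp (del-resp F C≐D) decDel) (Decomposable-resp (lk-resp F C≐D) decLk)

  -- A face G ⊇ F of C is recovered from the face G ─ F of the link of F.
  Decomposable⇒Decidable : ∀ {k} {C : Cx m} → Decomposable k C → ∀ G → Dec (C G)
  Decomposable⇒Decidable (simplex (σ , C⇔⊆σ)) G = map′ (from (C⇔⊆σ G)) (to (C⇔⊆σ G)) (G ⊆? σ)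
  Decomposable⇒Decidable {C = C} (shed _ _ F _ _ _ _ decDel decLk) G with F ⊆? G
  ... | no F⊈G  = map′ proj₁ (_, F⊈G) (Decomposable⇒Decidable decDel G)
  ... | yes F⊆G = map′ (subst C (q⊆p⇒p─q∪q≡p F⊆G) ∘ proj₂)
                       (λ cG → Empty-∩⁺ (x∈p─q⇒x∉q {p = G}) , subst C (sym (q⊆p⇒p─q∪q≡p F⊆G)) cG)
                       (Decomposable⇒Decidable decLk (G ─ F))

  PureCard-intro : ∀ {C : Cx m} {s} → Σ (Subset m) C →
    (∀ G → C G → ∃ λ K → C K × G ⊆ K × ∣ K ∣ ≡ s) → PureCard C s
  PureCard-intro {C} {s} face extend = face , covered , sized
    where
    facet : ∀ K → C K → ∣ K ∣ ≡ s → Facet C K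
    facet K cK ∣K∣≡s = cK , λ G cG K⊆G →
      let _ , _ , G⊆K′ , ∣K′∣≡s = extend G cG
      in p⊆q∧∣q∣≤∣p∣⇒p≡q K⊆G (≤-trans (p⊆q⇒∣p∣≤∣q∣ G⊆K′) (≤-reflexive (trans ∣K′∣≡s (sym ∣K∣≡s))))
    covered : ∀ G → C G → Σ (Subset m) λ F → Facet C F × G ⊆ F
    covered G cG = let K , cK , G⊆K , ∣K∣≡s = extend G cG in K , facet K cK ∣K∣≡s , G⊆K
    sized : ∀ F → Facet C F → ∣ F ∣ ≡ s
    sized F (cF , maximal) = let K , cK , F⊆K , ∣K∣≡s = extend F cF in trans (cong ∣_∣ (maximal K cK F⊆K)) ∣K∣≡s

  PureCard-extend : ∀ {C : Cx m} {s} → PureCard C s → ∀ G → C G → ∃ λ K → C K × G ⊆ K × ∣ K ∣ ≡ s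
  PureCard-extend (_ , covered , sized) G cG = let K , facet , G⊆K = covered G cG in K , proj₁ facet , G⊆K , sized K facet

  ⟪_⟫ : Subset m → Cx m
  ⟪ S ⟫ G = G ⊆ S

  ⟪⟫-decomposable : ∀ {k} S → Decomposable k ⟪ S ⟫
  ⟪⟫-decomposable S = simplex (S , λ G → ⇔.refl)

  ⟪⟫-pure : ∀ S → PureCard ⟪ S ⟫ ∣ S ∣
  ⟪⟫-pure S = PureCard-intro {C = ⟪ S ⟫} (S , ⊆-refl) extend
    where
    extend : ∀ G → G ⊆ S → ∃ λ K → K ⊆ S × G ⊆ K × ∣ K ∣ ≡ ∣ S ∣
    extend G G⊆S = S , ⊆-refl , G⊆S , refl

  ⊕-[] : ∀ {C : Cx m} → C ⊕ [] ≐ C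
  ⊕-[] G = mk⇔ [ id , (λ ()) ] inj₁

  ⊕-++ : ∀ {C : Cx m} A {B} → C ⊕ (A ++ B) ≐ (C ⊕ A) ⊕ B
  ⊕-++ A G = mk⇔ [ inj₁ ∘ inj₁ , Sum.map₁ inj₂ ∘ Any.++⁻ A ] [ Sum.map₂ Any.++⁺ˡ , inj₂ ∘ Any.++⁺ʳ A ]

  ⊕-pure : ∀ {C : Cx m} {s Fs} → PureCard C s → All (λ F → ∣ F ∣ ≡ s) Fs → PureCard (C ⊕ Fs) s
  ⊕-pure {C} {s} {Fs} pure sizes = PureCard-intro (let F , cF = proj₁ pure in F , inj₁ cF) extend
    where
    extend : ∀ G → (C ⊕ Fs) G → ∃ λ K → (C ⊕ Fs) K × G ⊆ K × ∣ K ∣ ≡ s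
    extend G (inj₁ cG) = Product.map₂ (Product.map₁ inj₁) (PureCard-extend pure G cG)
    extend G (inj₂ G⊆F∈Fs) =
      let F , F∈Fs , G⊆F = find G⊆F∈Fs in F , inj₂ (lose F∈Fs ⊆-refl) , G⊆F , All.lookup sizes F∈Fs

  ShedOrder : ℕ → Cx m → List (Subset m) → Set₁
  ShedOrder k C L = ∀ i → Decomposable k (C ⊕ take i L)

  ShedOrder-[] : ∀ {k} {C : Cx m} → Decomposable k C → ShedOrder k C []
  ShedOrder-[] dec i rewrite take-[] {A = Subset m} i = Decomposable-resp (≐-sym ⊕-[]) dec

  ShedOrder⇒Decomposable : ∀ {k} {C : Cx m} {L} → ShedOrder k C L → Decomposable k (C ⊕ L)
  ShedOrder⇒Decomposable {k} {C} {L} order =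
    subst (λ P → Decomposable k (C ⊕ P)) (take-all (length L) L ≤-refl) (order (length L))

  ShedOrder-++ : ∀ {k} {C : Cx m} {L N} → ShedOrder k C L → ShedOrder k (C ⊕ L) N → ShedOrder k C (L ++ N)
  ShedOrder-++ {k} {C} {L} {N} orderL orderN i with ≤-total i (length L)
  ... | inj₁ i≤∣L∣ = subst (λ P → Decomposable k (C ⊕ P)) (sym (take-++ˡ i L N i≤∣L∣)) (orderL i)
  ... | inj₂ ∣L∣≤i = subst (λ P → Decomposable k (C ⊕ P)) (sym (take-++ʳ i L N ∣L∣≤i))
                       (Decomposable-resp (≐-sym (⊕-++ L)) (orderN (i ∸ length L)))

  record Attachable (D : Cx m) (s : ℕ) (σ W : Subset m) : Set where
    field
      disjoint : Empty (W ∩ σ)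
      size     : ∣ W ∪ σ ∣ ≡ s
      boundary : ∀ G → G ⊆ W ∪ σ → σ ⊈ G → D G
  open Attachable

  ⟪⟫⊕-find : ∀ {S : Subset m} {Ws G} → (⟪ S ⟫ ⊕ Ws) G → ∃ λ W → W ∈ₗ S ∷ Ws × G ⊆ W
  ⟪⟫⊕-find (inj₁ G⊆S) = _ , here refl , G⊆S
  ⟪⟫⊕-find (inj₂ G⊆W∈Ws) = let W , W∈Ws , G⊆W = find G⊆W∈Ws in W , there W∈Ws , G⊆W

  ⟪⟫⊕-lose : ∀ {S : Subset m} {Ws G W} → W ∈ₗ S ∷ Ws → G ⊆ W → (⟪ S ⟫ ⊕ Ws) G
  ⟪⟫⊕-lose (here refl) G⊆W = inj₁ G⊆W
  ⟪⟫⊕-lose (there W∈Ws) G⊆W = inj₂ (lose W∈Ws G⊆W)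

  -- σ is a shedding face: deleting it gives back D, and its link is generated by the W's.
  cone-decomposable : ∀ {k} {D : Cx m} {s σ S Ws} → PureCard D s → Decomposable k D →
    Nonempty σ → ∣ σ ∣ ≤ suc k → (∀ G → D G → σ ⊈ G) → All (Attachable D s σ) (S ∷ Ws) →
    Decomposable k (⟪ S ⟫ ⊕ Ws) → Decomposable k (D ⊕ map (_∪ σ) (S ∷ Ws))
  cone-decomposable {D = D} {s} {σ} {S} {Ws} pure dec nonempty small σ∉D attach decLk =
    shed s (⊕-pure pure (All.map⁺ (All.map size attach))) σ (inj₂ (here (q⊆p∪q S σ))) nonempty small
      (PureCard-resp (≐-sym del≐D) pure) (Decomposable-resp (≐-sym del≐D) dec) (Decomposable-resp (≐-sym lk≐) decLk)
    where
    X : Cx m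
    X = D ⊕ map (_∪ σ) (S ∷ Ws)

    del≐D : del σ X ≐ D
    del≐D G = mk⇔ delete (λ dG → inj₁ dG , σ∉D G dG)
      where
      delete : del σ X G → D G
      delete (inj₁ dG , _) = dG
      delete (inj₂ G⊆W∪σ , σ⊈G) =
        let W , W∈ , G⊆ = find (Any.map⁻ G⊆W∪σ) in boundary (All.lookup attach W∈) G G⊆ σ⊈G

    lk≐ : lk σ X ≐ ⟪ S ⟫ ⊕ Ws
    lk≐ G = mk⇔ link unlink
      where
      link : lk σ X G → (⟪ S ⟫ ⊕ Ws) G
      link (_ , inj₁ dG∪σ) = contradiction (λ {x} → q⊆p∪q G σ {x}) (σ∉D _ dG∪σ)
      link (G∩σ≡∅ , inj₂ G∪σ⊆W∪σ) =
        let W , W∈ , G∪σ⊆ = find (Any.map⁻ G∪σ⊆W∪σ) in ⟪⟫⊕-lose W∈ (∪-cancelʳ-⊆ G∩σ≡∅ G∪σ⊆)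
      unlink : (⟪ S ⟫ ⊕ Ws) G → lk σ X G
      unlink face =
        let W , W∈ , G⊆W = ⟪⟫⊕-find face
        in Empty-∩⁺ (λ x∈G → Empty-∩⁻ (disjoint (All.lookup attach W∈)) (G⊆W x∈G)) ,
           inj₂ (Any.map⁺ (lose W∈ (∪-monoˡ-⊆ σ G⊆W)))

  ShedOrder-cone : ∀ {k} {D : Cx m} {s σ S Ws} → PureCard D s → Decomposable k D →
    Nonempty σ → ∣ σ ∣ ≤ suc k → (∀ G → D G → σ ⊈ G) → All (Attachable D s σ) (S ∷ Ws) →
    ShedOrder k ⟪ S ⟫ Ws → ShedOrder k D (map (_∪ σ) (S ∷ Ws))
  ShedOrder-cone pure dec _ _ _ _ _ zero = Decomposable-resp (≐-sym ⊕-[]) dec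
  ShedOrder-cone {σ = σ} {Ws = Ws} pure dec nonempty small σ∉D attach order (suc j)
    rewrite take-map {f = _∪ σ} j Ws =
    cone-decomposable pure dec nonempty small σ∉D (All.take⁺ (suc j) attach) (order j)

  Unique-++-cone : ∀ {σ : Subset m} {L Ws} → Unique L → All (σ ⊈_) L →
    Unique Ws → All (λ W → Empty (W ∩ σ)) Ws → Unique (L ++ map (_∪ σ) Ws)
  Unique-++-cone {σ} {L} {Ws} uniqueL σ⊈L uniqueWs disjoint =
    Unique.++⁺ uniqueL (unique-map uniqueWs disjoint) new
    where
    unique-map : ∀ {Ws} → Unique Ws → All (λ W → Empty (W ∩ σ)) Ws → Unique (map (_∪ σ) Ws)
    unique-map [] [] = []
    unique-map (W≢Ws ∷ uniqueWs) (W∩σ≡∅ ∷ disjoint) =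
      All.map⁺ (All.zipWith (λ (W≢W′ , W′∩σ≡∅) → W≢W′ ∘ ∪-cancelʳ W∩σ≡∅ W′∩σ≡∅) (W≢Ws , disjoint))
      ∷ unique-map uniqueWs disjoint
    new : Disjoint L (map (_∪ σ) Ws)
    new (K∈L , K∈Ws∪σ) with ∈-map⁻ (_∪ σ) K∈Ws∪σ
    ... | W , _ , refl = All.lookup σ⊈L K∈L (q⊆p∪q W σ)

-- Neighbourhoods are closed (x ∈ nbr x), so a clique is a set contained in the neighbourhood of each of its vertices.
record Graph (m : ℕ) : Set where
  field
    nbr      : Fin m → Subset m
    nbr-refl : ∀ x → x ∈ nbr x
    nbr-sym  : ∀ {x y} → y ∈ nbr x → x ∈ nbr y

open Graph public

module _ {m : ℕ} where

  IsClique : Graph m → Subset m → Set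
  IsClique G K = ∀ {x} → x ∈ K → K ⊆ nbr G x

  record CliqueIn (G : Graph m) (U : Subset m) (s : ℕ) (K : Subset m) : Set where
    field
      within : K ⊆ U
      card   : ∣ K ∣ ≡ s
      clique : IsClique G K
  open CliqueIn public

  Universal : Graph m → Subset m → Subset m → Set
  Universal G H U = ∀ {h} → h ∈ H → U ⊆ nbr G h

  Extendable : Graph m → Subset m → ℕ → Set
  Extendable G U s = ∀ {W} → CliqueIn G U s W → ∃ λ y → y ∈ U × y ∉ W × W ⊆ nbr G y

  IsClique-⊆ : ∀ {G K K′} → K ⊆ K′ → IsClique G K′ → IsClique G K
  IsClique-⊆ K⊆K′ clique x∈K y∈K = clique (K⊆K′ x∈K) (K⊆K′ y∈K)

  IsClique-∪⁅⁆ : ∀ {G K y} → IsClique G K → K ⊆ nbr G y → IsClique G (K ∪ ⁅ y ⁆)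
  IsClique-∪⁅⁆ {G} {K} clique K⊆Ny x∈ z∈ with x∈p∪⁅y⁆⁻ K x∈ | x∈p∪⁅y⁆⁻ K z∈
  ... | inj₁ x∈K | inj₁ z∈K = clique x∈K z∈K
  ... | inj₁ x∈K | inj₂ refl = nbr-sym G (K⊆Ny x∈K)
  ... | inj₂ refl | inj₁ z∈K = K⊆Ny z∈K
  ... | inj₂ refl | inj₂ refl = nbr-refl G _

  Universal⇒IsClique : ∀ {G H U} → H ⊆ U → Universal G H U → IsClique G H
  Universal⇒IsClique H⊆U universal h∈H z∈H = universal h∈H (H⊆U z∈H)

  CliqueIn-⊆ : ∀ {G U U′ s K} → U ⊆ U′ → CliqueIn G U s K → CliqueIn G U′ s K
  CliqueIn-⊆ U⊆U′ cK = record { within = U⊆U′ ∘ within cK ; card = card cK ; clique = clique cK }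

  CliqueIn-∪⁅⁆ : ∀ {G U s W y} → CliqueIn G U s W → y ∈ U → y ∉ W → W ⊆ nbr G y →
    CliqueIn G U (suc s) (W ∪ ⁅ y ⁆)
  CliqueIn-∪⁅⁆ {G} {U} {W = W} cW y∈U y∉W W⊆Ny = record
    { within = λ x∈ → [ within cW , (λ { refl → y∈U }) ] (x∈p∪⁅y⁆⁻ W x∈)
    ; card   = trans (x∉p⇒∣p∪⁅x⁆∣≡1+∣p∣ y∉W) (cong suc (card cW))
    ; clique = IsClique-∪⁅⁆ {G} (clique cW) W⊆Ny
    }

  record CliqueOrder (k : ℕ) (G : Graph m) (s : ℕ) (U : Subset m) : Set₁ where
    field
      first    : Subset m
      rest     : List (Subset m)
      sound    : All (CliqueIn G U s) (first ∷ rest)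
      complete : ∀ {K} → CliqueIn G U s K → K ∈ₗ first ∷ rest
      unique   : Unique (first ∷ rest)
      order    : ShedOrder k ⟪ first ⟫ rest

  CliqueOrder-single : ∀ {k G U s S} → CliqueIn G U s S → (∀ {K} → CliqueIn G U s K → K ≡ S) → CliqueOrder k G s U
  CliqueOrder-single {S = S} cS only = record
    { first = S ; rest = [] ; sound = cS ∷ [] ; complete = here ∘ only ; unique = [] ∷ []
    ; order = ShedOrder-[] (⟪⟫-decomposable S) }

  CliqueOrder-insert : ∀ {k G t D w} → w ∉ D → Extendable G D t →
    CliqueOrder k G (suc t) D → CliqueOrder k G t (D ∩ nbr G w) → CliqueOrder k G (suc t) (D ∪ ⁅ w ⁆)
  CliqueOrder-insert {k} {G} {t} {D} {w} w∉D extendable old link = record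
    { first    = O.first
    ; rest     = O.rest ++ map (_∪ ⁅ w ⁆) (L.first ∷ L.rest)
    ; sound    = All.++⁺ (All.map (CliqueIn-⊆ (p⊆p∪q ⁅ w ⁆)) O.sound) (All.map⁺ (All.map cone L.sound))
    ; complete = complete
    ; unique   = Unique-++-cone O.unique (All.map (λ cK ⁅w⁆⊆K → w∉D (within cK (⁅w⁆⊆K (x∈⁅x⁆ w)))) O.sound)
                   L.unique (All.map (Attachable.disjoint ∘ attach) L.sound)
    ; order    = ShedOrder-++ O.order
                   (ShedOrder-cone pure (ShedOrder⇒Decomposable O.order) (w , x∈⁅x⁆ w) small new
                     (All.map attach L.sound) L.order)
    }
    where
    module O = CliqueOrder old
    module L = CliqueOrder link

    w∈D∪w : w ∈ D ∪ ⁅ w ⁆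
    w∈D∪w = q⊆p∪q D ⁅ w ⁆ (x∈⁅x⁆ w)

    cone : ∀ {W} → CliqueIn G (D ∩ nbr G w) t W → CliqueIn G (D ∪ ⁅ w ⁆) (suc t) (W ∪ ⁅ w ⁆)
    cone {W} cW = CliqueIn-∪⁅⁆ (CliqueIn-⊆ (p⊆p∪q ⁅ w ⁆ ∘ p∩q⊆p D _) cW) w∈D∪w
                    (w∉D ∘ p∩q⊆p D _ ∘ within cW) (p∩q⊆q D _ ∘ within cW)

    complete : ∀ {K} → CliqueIn G (D ∪ ⁅ w ⁆) (suc t) K →
      K ∈ₗ O.first ∷ O.rest ++ map (_∪ ⁅ w ⁆) (L.first ∷ L.rest)
    complete {K} cK with w ∈? K
    ... | no w∉K  = ∈-++⁺ˡ (O.complete (record { within = K⊆D ; card = card cK ; clique = clique cK }))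
      where
      K⊆D : K ⊆ D
      K⊆D x∈K = [ id , (λ { refl → contradiction x∈K w∉K }) ] (x∈p∪⁅y⁆⁻ D (within cK x∈K))
    ... | yes w∈K = subst (_∈ₗ _) (q⊆p⇒p─q∪q≡p (x∈p⇒⁅x⁆⊆p w∈K))
                      (∈-++⁺ʳ (O.first ∷ O.rest) (∈-map⁺ (_∪ ⁅ w ⁆) (L.complete K-w)))
      where
      K-w : CliqueIn G (D ∩ nbr G w) t (K - w)
      K-w = record
        { within = λ {x} x∈K-w →
            let x∈K = p─q⊆p K ⁅ w ⁆ x∈K-w
                x∈D = [ id , (λ { refl → contradiction (x∈⁅x⁆ w) (x∈p─q⇒x∉q x∈K-w) }) ]
                        (x∈p∪⁅y⁆⁻ D (within cK x∈K))
            in x∈p∩q⁺ (x∈D , clique cK w∈K x∈K)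
        ; card   = suc-injective (trans (x∈p⇒1+∣p-x∣≡∣p∣ w∈K) (card cK))
        ; clique = IsClique-⊆ {G} (p─q⊆p K ⁅ w ⁆) (clique cK)
        }

    pure : PureCard (⟪ O.first ⟫ ⊕ O.rest) (suc t)
    pure with O.sound
    ... | c-first ∷ c-rest = ⊕-pure (subst (PureCard ⟪ O.first ⟫) (card c-first) (⟪⟫-pure O.first)) (All.map card c-rest)

    small : ∣ ⁅ w ⁆ ∣ ≤ suc k
    small = subst (_≤ suc k) (sym (∣⁅x⁆∣≡1 w)) (s≤s z≤n)

    new : ∀ F → (⟪ O.first ⟫ ⊕ O.rest) F → ⁅ w ⁆ ⊈ F
    new F face ⁅w⁆⊆F =
      let K , K∈ , F⊆K = ⟪⟫⊕-find face
      in w∉D (within (All.lookup O.sound K∈) (F⊆K (⁅w⁆⊆F (x∈⁅x⁆ w))))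

    attach : ∀ {W} → CliqueIn G (D ∩ nbr G w) t W → Attachable (⟪ O.first ⟫ ⊕ O.rest) (suc t) ⁅ w ⁆ W
    attach {W} cW = record
      { disjoint = Empty-∩⁺ (λ x∈W x∈⁅w⁆ →
                     w∉D (subst (_∈ D) (x∈⁅y⁆⇒x≡y w x∈⁅w⁆) (p∩q⊆p D _ (within cW x∈W))))
      ; size     = card (cone cW)
      ; boundary = boundary
      }
      where
      cW-in-D : CliqueIn G D t W
      cW-in-D = CliqueIn-⊆ (p∩q⊆p D _) cW
      boundary : ∀ F → F ⊆ W ∪ ⁅ w ⁆ → ⁅ w ⁆ ⊈ F → (⟪ O.first ⟫ ⊕ O.rest) F
      boundary F F⊆W∪w ⁅w⁆⊈F =
        let y , y∈D , y∉W , W⊆Ny = extendable cW-in-D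
            F⊆W : F ⊆ W
            F⊆W x∈F = [ id , (λ { refl → contradiction (λ {z} → x∈p⇒⁅x⁆⊆p x∈F {z}) ⁅w⁆⊈F }) ]
                        (x∈p∪⁅y⁆⁻ W (F⊆W∪w x∈F))
        in ⟪⟫⊕-lose (O.complete (CliqueIn-∪⁅⁆ cW-in-D y∈D y∉W W⊆Ny)) (p⊆p∪q ⁅ y ⁆ ∘ F⊆W)

  private
    Covers : Subset m → Subset m → List (Fin m) → Set
    Covers U D ws = ∀ {y} → y ∈ U → y ∈ D ⊎ y ∈ₗ ws

    Covers-skip : ∀ {U D w ws} → (w ∈ U → w ∈ D) → Covers U D (w ∷ ws) → Covers U D ws
    Covers-skip w∈D covers y∈U with covers y∈U
    ... | inj₁ y∈D = inj₁ y∈D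
    ... | inj₂ (here refl) = inj₁ (w∈D y∈U)
    ... | inj₂ (there y∈ws) = inj₂ y∈ws

    Covers-insert : ∀ {U D w ws} → Covers U D (w ∷ ws) → Covers U (D ∪ ⁅ w ⁆) ws
    Covers-insert {D = D} {w} covers y∈U with covers y∈U
    ... | inj₁ y∈D = inj₁ (p⊆p∪q ⁅ w ⁆ y∈D)
    ... | inj₂ (here refl) = inj₁ (q⊆p∪q D ⁅ w ⁆ (x∈⁅x⁆ w))
    ... | inj₂ (there y∈ws) = inj₂ y∈ws

  mutual
    cliqueOrder : ∀ {k G} t {U H x} → H ⊆ U → ∣ H ∣ ≡ t → Universal G H U → x ∈ U → x ∉ H →
      CliqueOrder k G (suc t) U
    cliqueOrder {k} {G} t {U} {H} {x} H⊆U ∣H∣≡t universal x∈U x∉H =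
      grow (allFin m) D₀⊆U (λ {y} _ → inj₂ (∈-allFin y)) ⊆-refl (CliqueOrder-single D₀-clique D₀-only)
      where
      D₀ : Subset m
      D₀ = H ∪ ⁅ x ⁆

      D₀⊆U : D₀ ⊆ U
      D₀⊆U y∈D₀ = [ H⊆U , (λ { refl → x∈U }) ] (x∈p∪⁅y⁆⁻ H y∈D₀)

      D₀-clique : CliqueIn G D₀ (suc t) D₀
      D₀-clique =
        CliqueIn-∪⁅⁆ (record { within = p⊆p∪q ⁅ x ⁆ ; card = ∣H∣≡t ; clique = Universal⇒IsClique {G} H⊆U universal })
          (q⊆p∪q H ⁅ x ⁆ (x∈⁅x⁆ x)) x∉H (λ h∈H → nbr-sym G (universal h∈H x∈U))

      D₀-only : ∀ {K} → CliqueIn G D₀ (suc t) K → K ≡ D₀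
      D₀-only cK = p⊆q∧∣q∣≤∣p∣⇒p≡q (within cK) (≤-reflexive (trans (card D₀-clique) (sym (card cK))))

      extendable : ∀ {D} → D₀ ⊆ D → D ⊆ U → Extendable G D t
      extendable D₀⊆D D⊆U {W} cW with H ⊆? W
      ... | no H⊈W = let h , h∈H , h∉W = ⊈-witness H⊈W
                     in h , D₀⊆D (p⊆p∪q ⁅ x ⁆ h∈H) , h∉W , universal h∈H ∘ D⊆U ∘ within cW
      ... | yes H⊆W =
        x , D₀⊆D (q⊆p∪q H ⁅ x ⁆ (x∈⁅x⁆ x)) , x∉H ∘ W⊆H , λ z∈W → nbr-sym G (universal (W⊆H z∈W) x∈U)
        where
        W⊆H : W ⊆ H
        W⊆H = ⊆-reflexive (sym (p⊆q∧∣q∣≤∣p∣⇒p≡q H⊆W (≤-reflexive (trans (card cW) (sym ∣H∣≡t)))))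

      grow : ∀ ws {D} → D ⊆ U → Covers U D ws → D₀ ⊆ D → CliqueOrder k G (suc t) D → CliqueOrder k G (suc t) U
      grow [] D⊆U covers _ order =
        subst (CliqueOrder k G (suc t)) (⊆-antisym D⊆U (λ y∈U → [ id , (λ ()) ] (covers y∈U))) order
      grow (w ∷ ws) {D} D⊆U covers D₀⊆D order with w ∈? D | w ∈? U
      ... | yes w∈D | _      = grow ws D⊆U (Covers-skip (λ _ → w∈D) covers) D₀⊆D order
      ... | no _    | no w∉U = grow ws D⊆U (Covers-skip (λ w∈U → contradiction w∈U w∉U) covers) D₀⊆D order
      ... | no w∉D  | yes w∈U =
        grow ws (λ y∈ → [ D⊆U , (λ { refl → w∈U }) ] (x∈p∪⁅y⁆⁻ D y∈)) (Covers-insert covers) (p⊆p∪q ⁅ w ⁆ ∘ D₀⊆D)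
          (CliqueOrder-insert w∉D (extendable D₀⊆D D⊆U) order
            (cliqueOrder-exact t (λ h∈H → x∈p∩q⁺ (D₀⊆D (p⊆p∪q ⁅ x ⁆ h∈H) , nbr-sym G (universal h∈H w∈U)))
              ∣H∣≡t (λ h∈H → universal h∈H ∘ D⊆U ∘ p∩q⊆p D _)))

    cliqueOrder-exact : ∀ {k G} t {U H} → H ⊆ U → ∣ H ∣ ≡ t → Universal G H U → CliqueOrder k G t U
    cliqueOrder-exact {k} {G} zero H⊆U ∣H∣≡0 universal =
      CliqueOrder-single (record { within = H⊆U ; card = ∣H∣≡0 ; clique = Universal⇒IsClique {G} H⊆U universal })
        (λ cK → p⊆q∧∣q∣≤∣p∣⇒p≡q (λ x∈K → contradiction x∈K (∣p∣≡0⇒x∉p (card cK)))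
                                 (≤-reflexive (trans ∣H∣≡0 (sym (card cK)))))
    cliqueOrder-exact (suc t) {U} {H} H⊆U ∣H∣≡1+t universal =
      let x , x∈H , _ = ⊈-witness (∣p∣<∣q∣⇒q⊈p {p = ⊥} {q = H}
                                     (subst₂ _<_ (sym (∣⊥∣≡0 m)) (sym ∣H∣≡1+t) (s≤s z≤n)))
      in cliqueOrder t (H⊆U ∘ p─q⊆p H ⁅ x ⁆) (suc-injective (trans (x∈p⇒1+∣p-x∣≡∣p∣ x∈H) ∣H∣≡1+t))
           (universal ∘ p─q⊆p H ⁅ x ⁆) (H⊆U x∈H) (λ x∈H-x → x∈p─q⇒x∉q x∈H-x (x∈⁅x⁆ x))

module _ {m : ℕ} where

  addCliqueNbr : Graph m → Subset m → Fin m → Subset m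
  addCliqueNbr G σ x with x ∈? σ
  ... | yes _ = nbr G x ∪ σ
  ... | no _  = nbr G x

  ∈-addCliqueNbr⁻ : ∀ G σ {x y} → y ∈ addCliqueNbr G σ x → y ∈ nbr G x ⊎ (x ∈ σ × y ∈ σ)
  ∈-addCliqueNbr⁻ G σ {x} y∈ with x ∈? σ
  ... | yes x∈σ = Sum.map₂ (x∈σ ,_) (x∈p∪q⁻ (nbr G x) σ y∈)
  ... | no _    = inj₁ y∈

  ∈-addCliqueNbr⁺ : ∀ G σ {x y} → y ∈ nbr G x ⊎ (x ∈ σ × y ∈ σ) → y ∈ addCliqueNbr G σ x
  ∈-addCliqueNbr⁺ G σ {x} y∈ with x ∈? σ | y∈
  ... | yes _   | inj₁ y∈Nx       = p⊆p∪q σ y∈Nx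
  ... | yes _   | inj₂ (_ , y∈σ)  = q⊆p∪q (nbr G x) σ y∈σ
  ... | no _    | inj₁ y∈Nx       = y∈Nx
  ... | no x∉σ  | inj₂ (x∈σ , _)  = contradiction x∈σ x∉σ

  addClique : Graph m → Subset m → Graph m
  addClique G σ = record
    { nbr      = addCliqueNbr G σ
    ; nbr-refl = λ x → ∈-addCliqueNbr⁺ G σ (inj₁ (nbr-refl G x))
    ; nbr-sym  = ∈-addCliqueNbr⁺ G σ ∘ Sum.map (nbr-sym G) swap ∘ ∈-addCliqueNbr⁻ G σ
    }

  nbr-addClique⁺ : ∀ G σ {x} → nbr G x ⊆ nbr (addClique G σ) x
  nbr-addClique⁺ G σ = ∈-addCliqueNbr⁺ G σ ∘ inj₁

  nbr-addClique⁻ : ∀ G σ {x y} → y ∈ nbr (addClique G σ) x → y ∉ σ → y ∈ nbr G x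
  nbr-addClique⁻ G σ {x} y∈ y∉σ = [ id , (λ (_ , y∈σ) → contradiction y∈σ y∉σ) ] (∈-addCliqueNbr⁻ G σ {x} y∈)

  CliqueIn-addClique⁺ : ∀ {G : Graph m} {σ U s K} → CliqueIn G U s K → CliqueIn (addClique G σ) U s K
  CliqueIn-addClique⁺ {G} {σ} cK =
    record { within = within cK ; card = card cK ; clique = λ x∈K → nbr-addClique⁺ G σ ∘ clique cK x∈K }

  CliqueIn-addClique⁻ : ∀ {G : Graph m} {u v U s K} → u ∉ K ⊎ v ∉ K →
    CliqueIn (addClique G (⁅ u ⁆ ∪ ⁅ v ⁆)) U s K → CliqueIn G U s K
  CliqueIn-addClique⁻ {G} {u} {v} {K = K} missing cK = record { within = within cK ; card = card cK ; clique = clique′ }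
    where
    not-both : ¬ (u ∈ K × v ∈ K)
    not-both (u∈K , v∈K) = [ (λ u∉K → u∉K u∈K) , (λ v∉K → v∉K v∈K) ] missing
    same : ∀ {x y} → x ∈ K → y ∈ K → x ∈ ⁅ u ⁆ ∪ ⁅ v ⁆ → y ∈ ⁅ u ⁆ ∪ ⁅ v ⁆ → x ≡ y
    same x∈K y∈K x∈σ y∈σ with x∈⁅y⁆∪⁅z⁆⁻ x∈σ | x∈⁅y⁆∪⁅z⁆⁻ y∈σ
    ... | inj₁ refl | inj₁ refl = refl
    ... | inj₂ refl | inj₂ refl = refl
    ... | inj₁ refl | inj₂ refl = contradiction (x∈K , y∈K) not-both
    ... | inj₂ refl | inj₁ refl = contradiction (y∈K , x∈K) not-both
    clique′ : IsClique G K
    clique′ {x} x∈K {y} y∈K with ∈-addCliqueNbr⁻ G (⁅ u ⁆ ∪ ⁅ v ⁆) (clique cK x∈K y∈K)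
    ... | inj₁ y∈Nx = y∈Nx
    ... | inj₂ (x∈σ , y∈σ) = subst (_∈ nbr G x) (same x∈K y∈K x∈σ y∈σ) (nbr-refl G x)

  IsClique-addClique-∪ : ∀ {G : Graph m} {W σ} → IsClique G W → (∀ {a} → a ∈ σ → W ⊆ nbr G a) →
    IsClique (addClique G σ) (W ∪ σ)
  IsClique-addClique-∪ {G} {W} {σ} clique σ⊆N {x} x∈ {y} y∈ =
    ∈-addCliqueNbr⁺ G σ (edge (x∈p∪q⁻ W σ x∈) (x∈p∪q⁻ W σ y∈))
    where
    edge : x ∈ W ⊎ x ∈ σ → y ∈ W ⊎ y ∈ σ → y ∈ nbr G x ⊎ (x ∈ σ × y ∈ σ)
    edge (inj₁ x∈W) (inj₁ y∈W) = inj₁ (clique x∈W y∈W)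
    edge (inj₁ x∈W) (inj₂ y∈σ) = inj₁ (nbr-sym G (σ⊆N y∈σ x∈W))
    edge (inj₂ x∈σ) (inj₁ y∈W) = inj₁ (σ⊆N x∈σ y∈W)
    edge (inj₂ x∈σ) (inj₂ y∈σ) = inj₂ (x∈σ , y∈σ)

  Complete : Graph m → Set
  Complete G = ∀ x → ⊤ ⊆ nbr G x

  incomplete⇒nonEdge : ∀ {G : Graph m} → ¬ Complete G → ∃₂ λ u y → y ∉ nbr G u
  incomplete⇒nonEdge {G} incomplete =
    let u , ⊤⊈Nu = ¬∀⟶∃¬ m _ (λ x → ⊤ ⊆? nbr G x) incomplete
        y , _ , y∉Nu = ⊈-witness ⊤⊈Nu
    in u , y , y∉Nu

  nonEdge-avoids : ∀ {G : Graph m} {H u y} → Universal G H ⊤ → y ∉ nbr G u → u ∉ H × y ∉ H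
  nonEdge-avoids {G} universal y∉Nu =
    (λ u∈H → y∉Nu (universal u∈H ∈⊤)) , (λ y∈H → y∉Nu (nbr-sym G (universal y∈H ∈⊤)))

  CliqueComplex : Graph m → ℕ → Cx m
  CliqueComplex G s F = ∃ λ K → CliqueIn G ⊤ s K × F ⊆ K

  nonEdges : Graph m → ℕ
  nonEdges G = sum (map (λ x → ∣ ∁ (nbr G x) ∣) (allFin m))

  nonEdges-< : ∀ {G : Graph m} {G′ u v} → (∀ x → nbr G x ⊆ nbr G′ x) → v ∉ nbr G u → v ∈ nbr G′ u →
    nonEdges G′ < nonEdges G
  nonEdges-< {u = u} {v} G⊆G′ v∉Nu v∈N′u =
    sum-map-< (λ x → p⊆q⇒∣p∣≤∣q∣ (p⊆q⇒∁p⊇∁q (G⊆G′ x))) (∈-allFin u)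
      (p⊂q⇒∣p∣<∣q∣ (p⊂q⇒∁p⊃∁q (G⊆G′ u , v , v∈N′u , v∉Nu)))

  CliqueIn-∪⁅⁆∪⁅⁆ : ∀ {G : Graph m} {H k a b} → Universal G H ⊤ → ∣ H ∣ ≡ k →
    a ∉ H → b ∉ H → a ≢ b → b ∈ nbr G a →
    CliqueIn G ⊤ (suc (suc k)) (H ∪ ⁅ a ⁆ ∪ ⁅ b ⁆)
  CliqueIn-∪⁅⁆∪⁅⁆ {G} {H} {k} {a} {b} universal ∣H∣≡k a∉H b∉H a≢b b∈Na = record
    { within = λ _ → ∈⊤
    ; card   = trans (∣p∪⁅x⁆∪⁅y⁆∣≡2+∣p∣ a∉H b∉H a≢b) (cong (2 +_) ∣H∣≡k)
    ; clique = λ x∈ y∈ → edge (x∈p∪⁅y⁆∪⁅z⁆⁻ H x∈) (x∈p∪⁅y⁆∪⁅z⁆⁻ H y∈)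
    }
    where
    edge : ∀ {x y} → x ∈ H ⊎ x ≡ a ⊎ x ≡ b → y ∈ H ⊎ y ≡ a ⊎ y ≡ b → y ∈ nbr G x
    edge (inj₁ x∈H)        _                  = universal x∈H ∈⊤
    edge _                 (inj₁ y∈H)         = nbr-sym G (universal y∈H ∈⊤)
    edge (inj₂ (inj₁ refl)) (inj₂ (inj₁ refl)) = nbr-refl G a
    edge (inj₂ (inj₁ refl)) (inj₂ (inj₂ refl)) = b∈Na
    edge (inj₂ (inj₂ refl)) (inj₂ (inj₁ refl)) = nbr-sym G b∈Na
    edge (inj₂ (inj₂ refl)) (inj₂ (inj₂ refl)) = nbr-refl G b

  -- A (k+2)-clique either misses a vertex of H, which is adjacent to everything,
  -- or it is H plus an edge ab, which has a common neighbour c by hypothesis.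
  Extendable-from-edges : ∀ {G : Graph m} {H k} → Universal G H ⊤ → ∣ H ∣ ≡ k →
    (∀ {a b} → a ∉ H → b ∉ H → a ≢ b → b ∈ nbr G a →
       ∃ λ c → c ∉ H ∪ ⁅ a ⁆ ∪ ⁅ b ⁆ × a ∈ nbr G c × b ∈ nbr G c) →
    Extendable G ⊤ (2 + k)
  Extendable-from-edges {G} {H} universal ∣H∣≡k common {D} cD with H ⊆? D
  ... | no H⊈D = let h , h∈H , h∉D = ⊈-witness H⊈D in h , ∈⊤ , h∉D , λ _ → universal h∈H ∈⊤
  ... | yes H⊆D with p⊆q∧∣q∣≡2+∣p∣⇒q≡p∪⁅x⁆∪⁅y⁆ H⊆D (trans (card cD) (cong (2 +_) (sym ∣H∣≡k)))
  ...   | a , b , a∉H , b∉H , a≢b , refl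
    with common a∉H b∉H a≢b (clique cD (x∈p∪⁅x⁆∪⁅y⁆ H) (y∈p∪⁅x⁆∪⁅y⁆ H))
  ...     | c , c∉D , a∈Nc , b∈Nc = c , ∈⊤ , c∉D , λ z∈D → adjacent (x∈p∪⁅y⁆∪⁅z⁆⁻ H z∈D)
    where
    adjacent : ∀ {z} → z ∈ H ⊎ z ≡ a ⊎ z ≡ b → z ∈ nbr G c
    adjacent (inj₁ z∈H)         = nbr-sym G (universal z∈H ∈⊤)
    adjacent (inj₂ (inj₁ refl)) = a∈Nc
    adjacent (inj₂ (inj₂ refl)) = b∈Nc

module Filling {m k : ℕ} (C : Cx m) (H : Subset m) (∣H∣≡k : ∣ H ∣ ≡ k)
  (isComplex : IsComplex C) (pure : PureDim C (suc (suc k))) (decomposable : Decomposable 1 C)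
  (coned : FullyConed (suc (suc k)) C (_∈ H))
  (connected : ∀ {x y} → x ∉ H → y ∉ H → Star (λ a b → a ∉ H × C (⁅ a ⁆ ∪ ⁅ b ⁆)) x y) where

  d : ℕ
  d = suc (suc k)

  record Stage (G : Graph m) : Set₁ where
    field
      facets     : List (Subset m)
      spans      : C ⊕ facets ≐ CliqueComplex G (suc d)
      order      : ShedOrder 1 C facets
      unique     : Unique facets
      fresh      : All (λ K → ∣ K ∣ ≡ suc d × ¬ C K) facets
      extendable : Extendable G ⊤ d

  Adjacent₀ : Fin m → Fin m → Set
  Adjacent₀ x y = x ≡ y ⊎ C (⁅ x ⁆ ∪ ⁅ y ⁆)

  adjacent₀? : ∀ x y → Dec (Adjacent₀ x y)
  adjacent₀? x y = x ≟ y ⊎-dec Decomposable⇒Decidable decomposable (⁅ x ⁆ ∪ ⁅ y ⁆)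

  skeleton : Graph m
  skeleton = record
    { nbr      = λ x → select (adjacent₀? x)
    ; nbr-refl = λ x → ∈-select⁺ (adjacent₀? x) (inj₁ refl)
    ; nbr-sym  = λ {x} {y} y∈ →
        ∈-select⁺ (adjacent₀? y) (Sum.map sym (subst C (∪-comm ⁅ x ⁆ ⁅ y ⁆)) (∈-select⁻ (adjacent₀? x) y∈))
    }

  IsClique-face : ∀ {K} → C K → IsClique skeleton K
  IsClique-face {K} cK {x} x∈K {y} y∈K = ∈-select⁺ (adjacent₀? x) (inj₂ (isComplex K _ xy⊆K cK))
    where
    xy⊆K = x,y∈p⇒⁅x⁆∪⁅y⁆⊆p x∈K y∈K

  skeleton-edge : ∀ {a b} → b ∈ nbr skeleton a → a ≢ b → C (⁅ a ⁆ ∪ ⁅ b ⁆)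
  skeleton-edge {a} b∈Na a≢b = [ (λ a≡b → contradiction a≡b a≢b) , (λ cab → cab) ] (∈-select⁻ (adjacent₀? a) b∈Na)

  spans⇒edge : ∀ {G L} → C ⊕ L ≐ CliqueComplex G (suc d) → ∀ {x y} → C (⁅ x ⁆ ∪ ⁅ y ⁆) → y ∈ nbr G x
  spans⇒edge {G} spans {x} {y} cxy =
    let K , cK , xy⊆K = to (spans _) (inj₁ cxy)
    in clique cK (xy⊆K (p⊆p∪q ⁅ y ⁆ (x∈⁅x⁆ x))) (xy⊆K (q⊆p∪q ⁅ x ⁆ ⁅ y ⁆ (x∈⁅x⁆ y)))

  spans⇒universal : ∀ {G L} → C ⊕ L ≐ CliqueComplex G (suc d) → Universal G H ⊤
  spans⇒universal {G} spans {h} h∈H {y} _ with h ≟ y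
  ... | yes refl = nbr-refl G h
  ... | no h≢y  = spans⇒edge spans (proj₂ (proj₁ coned h y h∈H h≢y))

  stage₀ : Stage skeleton
  stage₀ = record
    { facets     = []
    ; spans      = spans₀
    ; order      = ShedOrder-[] decomposable
    ; unique     = []
    ; fresh      = []
    ; extendable = Extendable-from-edges (spans⇒universal spans₀) ∣H∣≡k common
    }
    where
    spans₀ : C ⊕ [] ≐ CliqueComplex skeleton (suc d)
    spans₀ = ≐-trans ⊕-[] λ F → mk⇔ (face⇒clique F) (clique⇒face F)
      where
      face⇒clique : ∀ F → C F → CliqueComplex skeleton (suc d) F
      face⇒clique F cF with PureCard-extend pure F cF
      ... | K , cK , F⊆K , ∣K∣≡1+d =
        K , record { within = λ _ → ∈⊤ ; card = ∣K∣≡1+d ; clique = IsClique-face cK } , F⊆K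
      clique⇒face : ∀ F → CliqueComplex skeleton (suc d) F → C F
      clique⇒face F (K , cK , F⊆K) = isComplex K F F⊆K
        (proj₁ (proj₂ coned K (card cK) (λ u v u∈K v∈K u≢v → u≢v , skeleton-edge (clique cK u∈K v∈K) u≢v)))
    common : ∀ {a b} → a ∉ H → b ∉ H → a ≢ b → b ∈ nbr skeleton a →
      ∃ λ c → c ∉ H ∪ ⁅ a ⁆ ∪ ⁅ b ⁆ × a ∈ nbr skeleton c × b ∈ nbr skeleton c
    common {a} {b} a∉H b∉H a≢b b∈Na =
      let K , cK , ab⊆K , ∣K∣≡1+d = PureCard-extend pure _ (skeleton-edge b∈Na a≢b)
          ∣H+ab∣≡d = trans (∣p∪⁅x⁆∪⁅y⁆∣≡2+∣p∣ a∉H b∉H a≢b) (cong (2 +_) ∣H∣≡k)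
          c , c∈K , c∉H+ab = ⊈-witness (∣p∣<∣q∣⇒q⊈p {p = H ∪ ⁅ a ⁆ ∪ ⁅ b ⁆} {q = K}
                                          (subst₂ _<_ (sym ∣H+ab∣≡d) (sym ∣K∣≡1+d) (n<1+n d)))
      in c , c∉H+ab , IsClique-face cK c∈K (ab⊆K (p⊆p∪q ⁅ b ⁆ (x∈⁅x⁆ a))) ,
                      IsClique-face cK c∈K (ab⊆K (q⊆p∪q ⁅ a ⁆ ⁅ b ⁆ (x∈⁅x⁆ b)))

  module AddEdge {G : Graph m} (S : Stage G) {u v w : Fin m}
    (v∉Nu : v ∉ nbr G u) (w∈Nu : w ∈ nbr G u) (w∈Nv : w ∈ nbr G v) (w∉H : w ∉ H) where

    open Stage S

    σ : Subset m
    σ = ⁅ u ⁆ ∪ ⁅ v ⁆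

    G′ : Graph m
    G′ = addClique G σ

    U : Subset m
    U = nbr G u ∩ nbr G v

    universal : Universal G H ⊤
    universal = spans⇒universal spans

    u∈σ : u ∈ σ
    u∈σ = p⊆p∪q ⁅ v ⁆ (x∈⁅x⁆ u)

    v∈σ : v ∈ σ
    v∈σ = q⊆p∪q ⁅ u ⁆ ⁅ v ⁆ (x∈⁅x⁆ v)

    u≢v : u ≢ v
    u≢v refl = v∉Nu (nbr-refl G u)

    U⊆N : ∀ {a} → a ∈ σ → U ⊆ nbr G a
    U⊆N a∈σ x∈U = [ (λ { refl → p∩q⊆p _ _ x∈U }) , (λ { refl → p∩q⊆q _ _ x∈U }) ] (x∈⁅y⁆∪⁅z⁆⁻ a∈σ)

    U∩σ≡∅ : ∀ {x} → x ∈ U → x ∉ σ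
    U∩σ≡∅ x∈U x∈σ =
      [ (λ { refl → v∉Nu (nbr-sym G (p∩q⊆q _ _ x∈U)) }) , (λ { refl → v∉Nu (p∩q⊆p _ _ x∈U) }) ] (x∈⁅y⁆∪⁅z⁆⁻ x∈σ)

    link : CliqueOrder 1 G (suc k) U
    link = cliqueOrder k (λ h∈H → x∈p∩q⁺ (nbr-sym G (universal h∈H ∈⊤) , nbr-sym G (universal h∈H ∈⊤)))
             ∣H∣≡k (λ h∈H _ → universal h∈H ∈⊤) (x∈p∩q⁺ (w∈Nu , w∈Nv)) w∉H
    module L = CliqueOrder link

    σ⊈face : ∀ F → (C ⊕ facets) F → σ ⊈ F
    σ⊈face F face σ⊆F =
      let K , cK , F⊆K = to (spans F) face in v∉Nu (clique cK (F⊆K (σ⊆F u∈σ)) (F⊆K (σ⊆F v∈σ)))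

    σ∉W : ∀ {W a} → CliqueIn G U (suc k) W → a ∈ σ → a ∉ W
    σ∉W cW a∈σ a∈W = U∩σ≡∅ (within cW a∈W) a∈σ

    cone : ∀ {W} → CliqueIn G U (suc k) W → CliqueIn G′ ⊤ (suc d) (W ∪ σ)
    cone cW = record
      { within = λ _ → ∈⊤
      ; card   = trans (∣p∪⁅x⁆∪⁅y⁆∣≡2+∣p∣ (σ∉W cW u∈σ) (σ∉W cW v∈σ) u≢v) (cong (2 +_) (card cW))
      ; clique = IsClique-addClique-∪ {G = G} (clique cW) (λ a∈σ → U⊆N a∈σ ∘ within cW)
      }

    attach : ∀ {W} → CliqueIn G U (suc k) W → Attachable (C ⊕ facets) (suc d) σ W
    attach {W} cW = record
      { disjoint = Empty-∩⁺ (U∩σ≡∅ ∘ within cW)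
      ; size     = card (cone cW)
      ; boundary = boundary
      }
      where
      boundary : ∀ F → F ⊆ W ∪ σ → σ ⊈ F → (C ⊕ facets) F
      boundary F F⊆W∪σ σ⊈F with ⊆∪pair⇒⊆∪one F⊆W∪σ σ⊈F
      ... | b , b∈σ , F⊆W∪b with CliqueIn-∪⁅⁆ (CliqueIn-⊆ (λ _ → ∈⊤) cW) ∈⊤ (σ∉W cW b∈σ) (U⊆N b∈σ ∘ within cW)
      ...   | cW∪b with extendable cW∪b
      ...     | y , _ , y∉W∪b , W∪b⊆Ny =
        from (spans F) (_ , CliqueIn-∪⁅⁆ cW∪b ∈⊤ y∉W∪b W∪b⊆Ny , p⊆p∪q ⁅ y ⁆ ∘ F⊆W∪b)

    facets′ : List (Subset m)
    facets′ = facets ++ map (_∪ σ) (L.first ∷ L.rest)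

    uncone : ∀ {K} → CliqueIn G′ ⊤ (suc d) K → u ∈ K → v ∈ K → CliqueIn G U (suc k) (K ─ σ)
    uncone {K} cK u∈K v∈K = record
      { within = λ x∈ → x∈p∩q⁺ (nbr-addClique⁻ G σ (clique cK u∈K (p─q⊆p K σ x∈)) (x∈p─q⇒x∉q x∈) ,
                                nbr-addClique⁻ G σ (clique cK v∈K (p─q⊆p K σ x∈)) (x∈p─q⇒x∉q x∈))
      ; card   = suc-injective (suc-injective (begin
          suc (suc ∣ K ─ σ ∣) ≡⟨ ∣p∪⁅x⁆∪⁅y⁆∣≡2+∣p∣ {p = K ─ σ}
                                   (λ u∈ → x∈p─q⇒x∉q {p = K} u∈ u∈σ) (λ v∈ → x∈p─q⇒x∉q {p = K} v∈ v∈σ) u≢v ⟨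
          ∣ (K ─ σ) ∪ σ ∣     ≡⟨ cong ∣_∣ (q⊆p⇒p─q∪q≡p σ⊆K) ⟩
          ∣ K ∣               ≡⟨ card cK ⟩
          suc d               ∎))
      ; clique = λ x∈ y∈ → nbr-addClique⁻ G σ (clique cK (p─q⊆p K σ x∈) (p─q⊆p K σ y∈)) (x∈p─q⇒x∉q y∈)
      }
      where
      open ≡-Reasoning
      σ⊆K = x,y∈p⇒⁅x⁆∪⁅y⁆⊆p u∈K v∈K

    spans′ : C ⊕ facets′ ≐ CliqueComplex G′ (suc d)
    spans′ = ≐-trans (⊕-++ facets) λ F → mk⇔ (forward F) (backward F)
      where
      forward : ∀ F → ((C ⊕ facets) ⊕ map (_∪ σ) (L.first ∷ L.rest)) F → CliqueComplex G′ (suc d) F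
      forward F (inj₁ face) = let K , cK , F⊆K = to (spans F) face in K , CliqueIn-addClique⁺ cK , F⊆K
      forward F (inj₂ F⊆cone) with find F⊆cone
      ... | K , K∈ , F⊆K with ∈-map⁻ (_∪ σ) K∈
      ...   | W , W∈ , refl = W ∪ σ , cone (All.lookup L.sound W∈) , F⊆K
      backward : ∀ F → CliqueComplex G′ (suc d) F → ((C ⊕ facets) ⊕ map (_∪ σ) (L.first ∷ L.rest)) F
      backward F (K , cK , F⊆K) with u ∈? K | v ∈? K
      ... | no u∉K  | _       = inj₁ (from (spans F) (K , CliqueIn-addClique⁻ (inj₁ u∉K) cK , F⊆K))
      ... | yes _   | no v∉K  = inj₁ (from (spans F) (K , CliqueIn-addClique⁻ (inj₂ v∉K) cK , F⊆K))
      ... | yes u∈K | yes v∈K =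
        inj₂ (lose (∈-map⁺ (_∪ σ) (L.complete (uncone cK u∈K v∈K)))
                   (subst (F ⊆_) (sym (q⊆p⇒p─q∪q≡p (x,y∈p⇒⁅x⁆∪⁅y⁆⊆p u∈K v∈K))) F⊆K))

    common : ∀ {a b} → a ∉ H → b ∉ H → a ≢ b → b ∈ nbr G′ a →
      ∃ λ c → c ∉ H ∪ ⁅ a ⁆ ∪ ⁅ b ⁆ × a ∈ nbr G′ c × b ∈ nbr G′ c
    common {a} {b} a∉H b∉H a≢b b∈N′a with ∈-addCliqueNbr⁻ G σ b∈N′a
    ... | inj₁ b∈Na =
      let c , _ , c∉S , S⊆Nc = extendable (CliqueIn-∪⁅⁆∪⁅⁆ universal ∣H∣≡k a∉H b∉H a≢b b∈Na)
      in c , c∉S , nbr-addClique⁺ G σ (S⊆Nc (x∈p∪⁅x⁆∪⁅y⁆ H)) , nbr-addClique⁺ G σ (S⊆Nc (y∈p∪⁅x⁆∪⁅y⁆ H))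
    ... | inj₂ (a∈σ , b∈σ) = w , w∉S , nbr-addClique⁺ G σ (σ⊆Nw a∈σ) , nbr-addClique⁺ G σ (σ⊆Nw b∈σ)
      where
      σ⊆Nw : σ ⊆ nbr G w
      σ⊆Nw x∈σ = [ (λ { refl → nbr-sym G w∈Nu }) , (λ { refl → nbr-sym G w∈Nv }) ] (x∈⁅y⁆∪⁅z⁆⁻ x∈σ)
      w∉S : w ∉ H ∪ ⁅ a ⁆ ∪ ⁅ b ⁆
      w∉S w∈S with x∈p∪⁅y⁆∪⁅z⁆⁻ H w∈S
      ... | inj₁ w∈H         = w∉H w∈H
      ... | inj₂ (inj₁ refl) = U∩σ≡∅ (x∈p∩q⁺ (w∈Nu , w∈Nv)) a∈σ
      ... | inj₂ (inj₂ refl) = U∩σ≡∅ (x∈p∩q⁺ (w∈Nu , w∈Nv)) b∈σ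

    stage : Stage G′
    stage = record
      { facets     = facets′
      ; spans      = spans′
      ; order      = ShedOrder-++ order
                       (ShedOrder-cone (⊕-pure pure (All.map proj₁ fresh)) (ShedOrder⇒Decomposable order)
                         (u , u∈σ) σ-small σ⊈face (All.map attach L.sound) L.order)
      ; unique     = Unique-++-cone unique (All.tabulate (λ K∈ → σ⊈face _ (inj₂ (lose K∈ ⊆-refl))))
                       L.unique (All.map (Attachable.disjoint ∘ attach) L.sound)
      ; fresh      = All.++⁺ fresh
                       (All.map⁺ (All.map (λ {W} cW → card (cone cW) , λ c → σ⊈face _ (inj₁ c) (q⊆p∪q W σ)) L.sound))
      ; extendable = Extendable-from-edges (λ h∈H → nbr-addClique⁺ G σ ∘ universal h∈H) ∣H∣≡k common
      }
      where
      σ-small : ∣ σ ∣ ≤ 2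
      σ-small = ≤-reflexive (trans (x∉p⇒∣p∪⁅x⁆∣≡1+∣p∣ (u≢v ∘ sym ∘ x∈⁅y⁆⇒x≡y u)) (cong suc (∣⁅x⁆∣≡1 u)))

    fewer-nonEdges : nonEdges G′ < nonEdges G
    fewer-nonEdges = nonEdges-< {G = G} {G′} (λ x → nbr-addClique⁺ G σ {x}) v∉Nu (∈-addCliqueNbr⁺ G σ (inj₂ (u∈σ , v∈σ)))

  -- On a path from u to a non-neighbour y avoiding H, take the first edge wv leaving nbr u.
  joinable : ∀ {G} → Stage G → ∀ {u y} → y ∉ nbr G u →
    ∃₂ λ v w → v ∉ nbr G u × w ∈ nbr G u × w ∈ nbr G v × w ∉ H
  joinable {G} S {u} y∉Nu with nonEdge-avoids {G = G} {H} (spans⇒universal (Stage.spans S)) y∉Nu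
  ... | u∉H , y∉H with Star-exit (_∈? nbr G u) (connected u∉H y∉H) (nbr-refl G u) y∉Nu
  ...   | w , v , (w∉H , cwv) , w∈Nu , v∉Nu = v , w , v∉Nu , w∈Nu , nbr-sym G (spans⇒edge (Stage.spans S) cwv) , w∉H

  saturate : ∀ {G} → Stage G → Acc _<_ (nonEdges G) → ∃ λ G′ → Stage G′ × Complete G′
  saturate {G} S (acc smaller) with all? (λ x → ⊤ ⊆? nbr G x)
  ... | yes complete  = G , S , complete
  ... | no incomplete with incomplete⇒nonEdge {G = G} incomplete
  ...   | u , y , y∉Nu with joinable S y∉Nu
  ...     | v , w , v∉Nu , w∈Nu , w∈Nv , w∉H =
    saturate (AddEdge.stage S v∉Nu w∈Nu w∈Nv w∉H) (smaller (AddEdge.fewer-nonEdges S v∉Nu w∈Nu w∈Nv w∉H))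

  filling : Σ (List (Subset m)) λ Fs →
    (∀ F → (F ∈ₗ Fs) ⇔ ((∣ F ∣ ≡ suc d) × ¬ C F)) × Unique Fs ×
    (∀ i → 1 ≤ i → i ≤ length Fs → Decomposable 1 (C ⊕ take i Fs))
  filling with saturate stage₀ (<-wellFounded _)
  ... | G , S , complete = facets , (λ F → mk⇔ (All.lookup fresh) (missing F)) , unique , λ i _ _ → order i
    where
    open Stage S
    missing : ∀ F → ∣ F ∣ ≡ suc d × ¬ C F → F ∈ₗ facets
    missing F (∣F∣≡1+d , ¬cF)
      with from (spans F) (F , record { within = λ _ → ∈⊤ ; card = ∣F∣≡1+d ; clique = λ _ _ → complete _ ∈⊤ } , ⊆-refl)
    ... | inj₁ cF = contradiction cF ¬cF
    ... | inj₂ F⊆facet with find F⊆facet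
    ...   | K , K∈ , F⊆K =
      subst (_∈ₗ facets) (sym (p⊆q∧∣q∣≤∣p∣⇒p≡q F⊆K (≤-reflexive (trans (proj₁ (All.lookup fresh K∈)) (sym ∣F∣≡1+d))))) K∈

coneVertices : ∀ n k → Subset (n + k)
coneVertices zero    k = ⊤
coneVertices (suc n) k = outside ∷ coneVertices n k

∣coneVertices∣ : ∀ n k → ∣ coneVertices n k ∣ ≡ k
∣coneVertices∣ zero    k = ∣⊤∣≡n k
∣coneVertices∣ (suc n) k = ∣coneVertices∣ n k

↑ʳ∈coneVertices : ∀ n {k} (j : Fin k) → n ↑ʳ j ∈ coneVertices n k
↑ʳ∈coneVertices zero    j = ∈⊤
↑ʳ∈coneVertices (suc n) j = there (↑ʳ∈coneVertices n j)

↑ˡ∉coneVertices : ∀ {n} k (i : Fin n) → i ↑ˡ k ∉ coneVertices n k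
↑ˡ∉coneVertices k (suc i) (there i∈) = ↑ˡ∉coneVertices k i i∈

↑ˡ⊎↑ʳ : ∀ n k (x : Fin (n + k)) → (∃ λ i → i ↑ˡ k ≡ x) ⊎ (∃ λ j → n ↑ʳ j ≡ x)
↑ˡ⊎↑ʳ n k x with splitAt n x | join-splitAt n k x
... | inj₁ i | i↑ˡk≡x = inj₁ (i , i↑ˡk≡x)
... | inj₂ j | n↑ʳj≡x = inj₂ (j , n↑ʳj≡x)

module _ {n k : ℕ} where

  ∈coneVertices⇒InH : ∀ {x} → x ∈ coneVertices n k → InH n (suc (suc k)) x
  ∈coneVertices⇒InH {x} x∈ with ↑ˡ⊎↑ʳ n k x
  ... | inj₁ (i , refl) = contradiction x∈ (↑ˡ∉coneVertices k i)
  ... | inj₂ inH        = inH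

  ∉coneVertices⇒vtx : ∀ {x} → x ∉ coneVertices n k → ∃ λ i → vtx (suc (suc k)) i ≡ x
  ∉coneVertices⇒vtx {x} x∉ with ↑ˡ⊎↑ʳ n k x
  ... | inj₁ vertex      = vertex
  ... | inj₂ (j , refl) = contradiction (↑ʳ∈coneVertices n j) x∉

  InducedConnected⇒paths : ∀ {C} → InducedConnected n (suc (suc k)) C → ∀ {x y} →
    x ∉ coneVertices n k → y ∉ coneVertices n k →
    Star (λ a b → a ∉ coneVertices n k × C (⁅ a ⁆ ∪ ⁅ b ⁆)) x y
  InducedConnected⇒paths connected x∉ y∉ with ∉coneVertices⇒vtx x∉ | ∉coneVertices⇒vtx y∉
  ... | i , refl | j , refl =
    gmap (vtx (suc (suc k))) (λ {a} adjacent → ↑ˡ∉coneVertices k a , proj₂ adjacent) (connected i j)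

proposition4p8 : (d n : ℕ) → 2 ≤ d → (C : Cx (n + (d ∸ 2))) →
    IsComplex C → AllVertices C → PureDim C d → Decomposable 1 C →
    FullyConed d C (InH n d) → InducedConnected n d C →
    Σ (List (Subset (n + (d ∸ 2)))) λ Fs →
      (∀ F → (F ∈ₗ Fs) ⇔ ((∣ F ∣ ≡ suc d) × ¬ C F)) × Unique Fs ×
      (∀ i → 1 ≤ i → i ≤ length Fs → Decomposable 1 (C ⊕ take i Fs))
proposition4p8 (suc (suc k)) n _ C isComplex _ pure decomposable (coned-H , cliques-facets) connected =
  Filling.filling C (coneVertices n k) (∣coneVertices∣ n k) isComplex pure decomposable
    ((λ h v h∈ → coned-H h v (∈coneVertices⇒InH h∈)) , cliques-facets) (InducedConnected⇒paths {C = C} connected)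
proposition4p8 1 _ (s≤s ()) _ _ _ _ _ _ _
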